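{- Let $G$ and $H$ be graphs with $V(G)=\{u_1,\dots,u_m\}$ and $V(H)=\{v_1,\dots,v_n\}$. For any vertex $w_{i,j}$ of $G\Box H$, $$EM_{G\Box H}(w_{i,j})=EM_{H_i}(w_{i,j})\cup EM_{G_j}(w_{i,j}).$$
   Context: Throughout, all graphs are finite, simple, undirected and connected. For a graph $X$, a set $M\subseteq V(X)$ and an edge $e\in E(X)$, $P_X(M,e)$ is the set of pairs $(x,y)$ with $x\in M$, $y\in V(X)$ such that $d_X(x,y)\neq d_{X-e}(x,y)$. For a vertex $x$ of $X$, $EM_X(x)$ is the set of edges $e$ of $X$ for which there is a vertex $v$ with $(x,v)\in P_X(\{x\},e)$. The Cartesian product $G\Box H$ has vertex set $\{w_{i,j}\}$ (with $w_{i,j}$ corresponding to $(u_i,v_j)$), where $w_{i,j}$ and $w_{i',j'}$ are adjacent iff either $i=i'$ and $v_jv_{j'}\in E(H)$, or $j=j'$ and $u_iu_{i'}\in E(G)$. $G_j$ is the subgraph of $G\Box H$ induced by $\{w_{i,j}:1\le i\le m\}$ and $H_i$ is the subgraph induced by $\{w_{i,j}:1\le j\le n\}$. -}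

module Defs where

open import Data.Nat using (ℕ; zero; suc; _≤_)
open import Data.Fin using (Fin)
open import Data.Product using (Σ; ∃; _×_; _,_; proj₁; proj₂)
open import Data.Sum using (_⊎_; inj₁; inj₂)
open import Relation.Nullary using (¬_)
open import Relation.Binary.PropositionalEquality using (_≡_; refl; sym)

record Graph (V : Set) : Set₁ where
  field
    Adj    : V → V → Set
    adj-sym    : ∀ {x y} → Adj x y → Adj y x
    adj-irrefl : ∀ {x} → ¬ Adj x x
open Graph public

data Walk {V : Set} (X : Graph V) : V → V → ℕ → Set where
  nil  : ∀ {x} → Walk X x x 0
  cons : ∀ {x y z k} → Adj X x y → Walk X y z k → Walk X x z (suc k)

Connected : {V : Set} → Graph V → Set
Connected X = ∀ x y → ∃ λ k → Walk X x y k

Dist : {V : Set} → Graph V → V → V → ℕ → Set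
Dist X x y k = Walk X x y k × (∀ k' → Walk X x y k' → k ≤ k')

SameEdge : {V : Set} → V → V → V → V → Set
SameEdge x y a b = (x ≡ a × y ≡ b) ⊎ (x ≡ b × y ≡ a)

removeEdge : {V : Set} → Graph V → V → V → Graph V
removeEdge X a b = record
  { Adj    = λ x y → Adj X x y × ¬ SameEdge x y a b
  ; adj-sym    = λ { (h , ne) → Graph.adj-sym X h , λ { (inj₁ (p , q)) → ne (inj₂ (q , p))
                                             ; (inj₂ (p , q)) → ne (inj₁ (q , p)) } }
  ; adj-irrefl = λ { (h , _) → Graph.adj-irrefl X h }
  }

-- d_X(x,y) ≠ d_{X-e}(x,y) for e = {a,b}: the value of d_X(x,y) is not a
-- value of d_{X-e}(x,y) (covers the case d_{X-e}(x,y) = ∞).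
DistChanges : {V : Set} → Graph V → V → V → V → V → Set
DistChanges X a b x y = ∀ k → Dist X x y k → ¬ Dist (removeEdge X a b) x y k

InP : {V : Set} → Graph V → V → V → V → V → Set
InP X a b x y = DistChanges X a b x y

InEM : {V : Set} → Graph V → V → V → V → Set
InEM X x a b = Adj X a b × ∃ λ v → InP X a b x v

induced : {V : Set} → Graph V → (P : V → Set) → Graph (Σ V P)
induced X P = record
  { Adj    = λ x y → Adj X (proj₁ x) (proj₁ y)
  ; adj-sym    = Graph.adj-sym X
  ; adj-irrefl = Graph.adj-irrefl X
  }

-- The edge {a,b} of X lies in EM_{X[P]}(x) (viewing edges of the induced
-- subgraph X[P] as edges of X).
InEMsub : {V : Set} → Graph V → (P : V → Set) → (x : V) → P x → V → V → Set
InEMsub X P x px a b =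
  Σ (P a) λ pa → Σ (P b) λ pb → InEM (induced X P) (x , px) (a , pa) (b , pb)

-- Cartesian product G □ H, vertex (i , j) is w_{i,j}.
_□_ : {U W : Set} → Graph U → Graph W → Graph (U × W)
G □ H = record
  { Adj    = λ p q → (proj₁ p ≡ proj₁ q × Adj H (proj₂ p) (proj₂ q))
                   ⊎ (proj₂ p ≡ proj₂ q × Adj G (proj₁ p) (proj₁ q))
  ; adj-sym    = λ { (inj₁ (e , h)) → inj₁ (sym e , Graph.adj-sym H h)
               ; (inj₂ (e , h)) → inj₂ (sym e , Graph.adj-sym G h) }
  ; adj-irrefl = λ { (inj₁ (_ , h)) → Graph.adj-irrefl H h
               ; (inj₂ (_ , h)) → Graph.adj-irrefl G h }
  }

-- H_i : vertex set {w_{i,j} : j}, G_j : vertex set {w_{i,j} : i}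
rowP : {U W : Set} → U → U × W → Set
rowP i p = proj₁ p ≡ i

colP : {U W : Set} → W → U × W → Set
colP j p = proj₂ p ≡ j

{-# OPTIONS --safe #-}
-- A walk in G □ H projects to a walk in G and a walk in H whose lengths add up, so
-- d((i,j),(v₁,v₂)) = d_G(i,v₁) + d_H(j,v₂), realised by L-shaped walks. By the symmetry
-- G □ H ≅ H □ G it suffices to consider an edge e lying in a row H_c. If c ≠ i, one of the
-- two L-shaped shortest walks from w_{i,j} to any vertex avoids e. If c = i, a shortest walk
-- to (v₁,v₂) may run inside H_i to (i,v₂) and then along G, so a distance from w_{i,j} that
-- changes in G □ H − e already changes in H_i − e; conversely a walk between two vertices
-- of H_i that leaves H_i is longer than some walk inside H_i.
module Submission where

open import Defs
open import Data.Nat using (ℕ; suc; _+_; _≤_; _<_; s≤s)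
open import Data.Nat.Properties using (+-comm; +-suc; +-mono-≤; m≤n+m; ≤⇒≯; ≮⇒≥)
open import Data.Nat.Induction using (<-rec)
open import Data.Fin using (Fin) renaming (_≟_ to _≟ᶠ_)
open import Data.Product using (Σ; ∃; ∃₂; _×_; _,_; proj₁; proj₂; swap)
open import Data.Sum using (_⊎_; inj₁; inj₂; [_,_])
import Data.Sum as Sum
open import Data.Empty using (⊥-elim)
open import Function using (id; _∘_)
open import Function.Definitions using (Injective)
open import Function.Bundles using (_⇔_; mk⇔; module Equivalence)
open import Relation.Nullary using (¬_; yes; no)
open import Relation.Nullary.Irrelevant using (Irrelevant)
open import Relation.Binary.Definitions using (DecidableEquality)
open import Relation.Binary.PropositionalEquality using (_≡_; refl; sym; trans; cong; subst; subst₂)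
open import Axiom.UniquenessOfIdentityProofs using (module Decidable⇒UIP)

private
  variable
    U V W : Set
    X Y : Graph V
    a b x y z : V
    k l : ℕ

infixr 5 _++_

_++_ : Walk X x y k → Walk X y z l → Walk X x z (k + l)
nil ++ q = q
cons e p ++ q = cons e (p ++ q)

record Hom (X : Graph V) (Y : Graph W) (f : V → W) : Set where
  constructor hom
  field map-adj : ∀ {x y} → Adj X x y → Adj Y (f x) (f y)
open Hom public

mapWalk : ∀ {X : Graph V} {Y : Graph W} {f : V → W} → Hom X Y f →
          Walk X x y k → Walk Y (f x) (f y) k
mapWalk φ nil = nil
mapWalk φ (cons e p) = cons (map-adj φ e) (mapWalk φ p)

LowerBound : Graph V → V → V → ℕ → Set
LowerBound X x y d = ∀ k → Walk X x y k → d ≤ k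

Dist-reflect : ∀ {X : Graph V} {Y : Graph W} {f : V → W} → Hom X Y f →
               Walk X x y k → Dist Y (f x) (f y) k → Dist X x y k
Dist-reflect φ w (_ , lower) = w , λ l w' → lower l (mapWalk φ w')

-- Walks are not decidable here, so distances exist only under a double negation; this
-- suffices because they are only ever used to refute DistChanges.
¬¬-least : {P : ℕ → Set} → P k → ¬ ¬ (∃ λ d → P d × ∀ k → P k → d ≤ k)
¬¬-least {k} {P} pk no-least = <-rec (λ n → ¬ P n) step k pk
  where
  step : ∀ n → (∀ {m} → m < n → ¬ P m) → ¬ P n
  step n below pn = no-least (n , pn , λ m pm → ≮⇒≥ (λ m<n → below m<n pm))

¬¬-Dist : Connected X → ∀ x y → ¬ ¬ (∃ (Dist X x y))
¬¬-Dist conn x y = ¬¬-least (proj₂ (conn x y))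

removeEdge-⊆ : Hom (removeEdge X a b) X id
removeEdge-⊆ = hom proj₁

avoiding : ∀ {X : Graph V} {Y : Graph W} {f : W → V} → Hom Y X f →
           (∀ {x y} → Adj Y x y → ¬ SameEdge (f x) (f y) a b) → Hom Y (removeEdge X a b) f
avoiding φ avoids = hom λ e → map-adj φ e , avoids e

shortest-avoiding⇒¬DistChanges : Walk (removeEdge X a b) x y k → LowerBound X x y k →
                                 ¬ DistChanges X a b x y
shortest-avoiding⇒¬DistChanges w lower changes =
  changes _ D (Dist-reflect removeEdge-⊆ w D)
  where D = mapWalk removeEdge-⊆ w , lower

SameEdge-map : (f : V → W) → SameEdge x y a b → SameEdge (f x) (f y) (f a) (f b)
SameEdge-map f (inj₁ (refl , refl)) = inj₁ (refl , refl)
SameEdge-map f (inj₂ (refl , refl)) = inj₂ (refl , refl)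

SameEdge-injective : {f : V → W} → Injective _≡_ _≡_ f →
                     SameEdge (f x) (f y) (f a) (f b) → SameEdge x y a b
SameEdge-injective inj (inj₁ (p , q)) = inj₁ (inj p , inj q)
SameEdge-injective inj (inj₂ (p , q)) = inj₂ (inj p , inj q)

record _≅_ (X : Graph V) (Y : Graph W) : Set where
  field
    to       : V → W
    from     : W → V
    to-hom   : Hom X Y to
    from-hom : Hom Y X from
    from∘to  : ∀ x → from (to x) ≡ x
    to∘from  : ∀ y → to (from y) ≡ y

≅-sym : X ≅ Y → Y ≅ X
≅-sym φ = record { to = from ; from = to ; to-hom = from-hom ; from-hom = to-hom
                 ; from∘to = to∘from ; to∘from = from∘to }
  where open _≅_ φ

removeEdge-≅ : (φ : X ≅ Y) → removeEdge X a b ≅ removeEdge Y (_≅_.to φ a) (_≅_.to φ b)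
removeEdge-≅ {a = a} {b = b} φ = record
  { to = to ; from = from ; from∘to = from∘to ; to∘from = to∘from
  ; to-hom = hom λ (e , ≢ab) → map-adj to-hom e , ≢ab ∘ SameEdge-injective to-injective
  ; from-hom = hom λ {x} {y} (e , ≢ab) → map-adj from-hom e , λ s →
      ≢ab (subst₂ (λ x' y' → SameEdge x' y' (to a) (to b)) (to∘from x) (to∘from y) (SameEdge-map to s))
  }
  where
  open _≅_ φ
  to-injective : Injective _≡_ _≡_ to
  to-injective {x} {y} tx≡ty = trans (sym (from∘to x)) (trans (cong from tx≡ty) (from∘to y))

Dist-≅ : (φ : X ≅ Y) → Dist Y (_≅_.to φ x) (_≅_.to φ y) k → Dist X x y k
Dist-≅ {x = x} {y = y} {k = k} φ D = Dist-reflect to-hom pulled D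
  where
  open _≅_ φ
  pulled : Walk _ x y k
  pulled = subst₂ (λ x' y' → Walk _ x' y' k) (from∘to x) (from∘to y) (mapWalk from-hom (proj₁ D))

InEM-≅ : (φ : X ≅ Y) → InEM X x a b → InEM Y (_≅_.to φ x) (_≅_.to φ a) (_≅_.to φ b)
InEM-≅ φ (e , v , changes) =
  map-adj to-hom e , to v , λ k D D' → changes k (Dist-≅ φ D) (Dist-≅ (removeEdge-≅ φ) D')
  where open _≅_ φ

induced-⊆ : {P : V → Set} → Hom (induced X P) X proj₁
induced-⊆ = hom id

removeEdge-induced : {P : V → Set} {a b : Σ V P} → (∀ x → Irrelevant (P x)) →
                     Hom (removeEdge (induced X P) a b) (removeEdge X (proj₁ a) (proj₁ b)) proj₁
removeEdge-induced irr = hom λ (e , ≢ab) → e , ≢ab ∘ SameEdge-injective proj₁-injective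
  where
  proj₁-injective : Injective _≡_ _≡_ proj₁
  proj₁-injective {x , p} {.x , q} refl = cong (x ,_) (irr x p q)

module _ (G : Graph U) (H : Graph W) where

  row-hom : (c : U) → Hom H (G □ H) (c ,_)
  row-hom c = hom λ e → inj₁ (refl , e)

  col-hom : (t : W) → Hom G (G □ H) (_, t)
  col-hom t = hom λ e → inj₂ (refl , e)

  row-hom-induced : (c : U) → Hom H (induced (G □ H) (rowP c)) (λ y → (c , y) , refl)
  row-hom-induced c = hom λ e → inj₁ (refl , e)

  □-swap : (G □ H) ≅ (H □ G)
  □-swap = record { to = swap ; from = swap ; to-hom = hom Sum.swap ; from-hom = hom Sum.swap
                  ; from∘to = λ _ → refl ; to∘from = λ _ → refl }

  row≅col : (c : U) → induced (G □ H) (rowP c) ≅ induced (H □ G) (colP c)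
  row≅col c = record { to = λ (p , e) → swap p , e ; from = λ (p , e) → swap p , e
                     ; to-hom = hom Sum.swap ; from-hom = hom Sum.swap
                     ; from∘to = λ _ → refl ; to∘from = λ _ → refl }

  □-project : ∀ {x₁ y₁ x₂ y₂} → Walk (G □ H) (x₁ , x₂) (y₁ , y₂) k →
              ∃₂ λ k₁ k₂ → Walk G x₁ y₁ k₁ × Walk H x₂ y₂ k₂ × k₁ + k₂ ≡ k
  □-project nil = 0 , 0 , nil , nil , refl
  □-project (cons (inj₁ (refl , e)) w) with □-project w
  ... | k₁ , k₂ , g , h , refl = k₁ , suc k₂ , g , cons e h , +-suc k₁ k₂
  □-project (cons (inj₂ (refl , e)) w) with □-project w
  ... | k₁ , k₂ , g , h , refl = suc k₁ , k₂ , cons e g , h , refl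

  □-LowerBound : ∀ {x₁ y₁ x₂ y₂ d₁ d₂} → LowerBound G x₁ y₁ d₁ → LowerBound H x₂ y₂ d₂ →
                 LowerBound (G □ H) (x₁ , x₂) (y₁ , y₂) (d₁ + d₂)
  □-LowerBound lower₁ lower₂ k w with □-project w
  ... | k₁ , k₂ , g , h , refl = +-mono-≤ (lower₁ k₁ g) (lower₂ k₂ h)

module Row (_≟_ : DecidableEquality U) (G : Graph U) (H : Graph W) where

  private
    variable
      c i r v₁ : U
      j t v₂ y₁ y₂ z₁ z₂ : W

  rowP-irrelevant : ∀ (p : U × W) → Irrelevant (rowP i p)
  rowP-irrelevant _ = Decidable⇒UIP.≡-irrelevant _≟_

  col-avoids-row-edge : ∀ {x x'} → Adj G x x' → ¬ SameEdge (x , t) (x' , t) (c , y₁) (c , y₂)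
  col-avoids-row-edge e (inj₁ (refl , refl)) = adj-irrefl G e
  col-avoids-row-edge e (inj₂ (refl , refl)) = adj-irrefl G e

  row-avoids-other-row : ¬ r ≡ c → ¬ SameEdge (r , z₁) (r , z₂) (c , y₁) (c , y₂)
  row-avoids-other-row r≢c (inj₁ (p , _)) = r≢c (cong proj₁ p)
  row-avoids-other-row r≢c (inj₂ (p , _)) = r≢c (cong proj₁ p)

  col-walk : ∀ {x x'} → Walk G x x' k →
             Walk (removeEdge (G □ H) (c , y₁) (c , y₂)) (x , t) (x' , t) k
  col-walk = mapWalk (avoiding (col-hom G H _) col-avoids-row-edge)

  row-walk : ¬ r ≡ c → Walk H z₁ z₂ k →
             Walk (removeEdge (G □ H) (c , y₁) (c , y₂)) (r , z₁) (r , z₂) k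
  row-walk r≢c = mapWalk (avoiding (row-hom G H _) λ _ → row-avoids-other-row r≢c)

  shortest-avoiding : ∀ {d₁ d₂} → ¬ c ≡ i → Walk G i v₁ d₁ → Walk H j v₂ d₂ →
                      Walk (removeEdge (G □ H) (c , y₁) (c , y₂)) (i , j) (v₁ , v₂) (d₁ + d₂)
  shortest-avoiding {c = c} {v₁ = v₁} {d₁ = d₁} {d₂} c≢i g h with v₁ ≟ c
  ... | no v₁≢c = col-walk g ++ row-walk v₁≢c h
  ... | yes refl = subst (Walk _ _ _) (+-comm d₂ d₁) (row-walk (c≢i ∘ sym) h ++ col-walk g)

  ¬DistChanges-off-row : Connected G → Connected H → ¬ c ≡ i →
                         ¬ DistChanges (G □ H) (c , y₁) (c , y₂) (i , j) (v₁ , v₂)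
  ¬DistChanges-off-row {i = i} {j = j} {v₁ = v₁} {v₂ = v₂} conn-G conn-H c≢i changes =
    ¬¬-Dist conn-G i v₁ λ (_ , g , lower₁) →
    ¬¬-Dist conn-H j v₂ λ (_ , h , lower₂) →
    shortest-avoiding⇒¬DistChanges (shortest-avoiding c≢i g h) (□-LowerBound G H lower₁ lower₂) changes

  DistChanges-in-row : Connected G → DistChanges (G □ H) (i , y₁) (i , y₂) (i , j) (v₁ , v₂) →
                       DistChanges (induced (G □ H) (rowP i)) ((i , y₁) , refl) ((i , y₂) , refl)
                                   ((i , j) , refl) ((i , v₂) , refl)
  DistChanges-in-row {i = i} {v₁ = v₁} conn-G changes k D D' =
    ¬¬-Dist conn-G i v₁ λ (d , g , lower) →
    shortest-avoiding⇒¬DistChanges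
      (subst (Walk _ _ _) (+-comm k d)
             (mapWalk (removeEdge-induced rowP-irrelevant) (proj₁ D') ++ col-walk g))
      (□-LowerBound G H lower (λ l h → proj₂ D l (mapWalk (row-hom-induced G H i) h)))
      changes

  EM⇒EMsub-row : Connected G → Connected H → InEM (G □ H) (i , j) (c , y₁) (c , y₂) →
                 InEMsub (G □ H) (rowP i) (i , j) refl (c , y₁) (c , y₂)
  EM⇒EMsub-row {i = i} {c = c} conn-G conn-H (e , (v₁ , v₂) , changes) with c ≟ i
  ... | no c≢i = ⊥-elim (¬DistChanges-off-row conn-G conn-H c≢i changes)
  ... | yes refl = refl , refl , e , ((c , v₂) , refl) , DistChanges-in-row conn-G changes

  row-walk⊎shorter : ∀ {a b} (pa : rowP i a) (pb : rowP i b) →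
    Walk (removeEdge (G □ H) a b) (i , y₁) (i , y₂) k →
    Walk (removeEdge (induced (G □ H) (rowP i)) (a , pa) (b , pb)) ((i , y₁) , refl) ((i , y₂) , refl) k
      ⊎ ∃ λ l → Walk H y₁ y₂ l × l < k
  row-walk⊎shorter pa pb nil = inj₁ nil
  row-walk⊎shorter pa pb (cons (inj₁ (refl , e) , ≢ab) w) with row-walk⊎shorter pa pb w
  ... | inj₁ w' = inj₁ (cons (inj₁ (refl , e) , ≢ab ∘ SameEdge-map proj₁) w')
  ... | inj₂ (l , h , l<k) = inj₂ (suc l , cons e h , s≤s l<k)
  row-walk⊎shorter pa pb (cons (inj₂ (refl , _) , _) w) with □-project G H (mapWalk removeEdge-⊆ w)
  ... | k₁ , k₂ , _ , h , refl = inj₂ (k₂ , h , s≤s (m≤n+m k₂ k₁))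

  EMsub-row⇒EM : ∀ {a b} → InEMsub (G □ H) (rowP i) (i , j) refl a b → InEM (G □ H) (i , j) a b
  EMsub-row⇒EM {i = i} (pa , pb , e , ((_ , v₂) , refl) , changes) = e , (i , v₂) , λ k D D' →
    [ (λ w → let D-row = Dist-reflect induced-⊆ (mapWalk removeEdge-⊆ w) D in
             changes k D-row (Dist-reflect removeEdge-⊆ w D-row))
    , (λ (l , h , l<k) → ≤⇒≯ (proj₂ D l (mapWalk (row-hom G H i) h)) l<k)
    ] (row-walk⊎shorter pa pb (proj₁ D'))

module _ (_≟U_ : DecidableEquality U) (_≟W_ : DecidableEquality W) (G : Graph U) (H : Graph W) where

  private
    module GH = Row _≟U_ G H
    module HG = Row _≟W_ H G

  EMsub-col⇔EMsub-row-swap : ∀ {i j a b} →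
    InEMsub (G □ H) (colP j) (i , j) refl a b ⇔ InEMsub (H □ G) (rowP j) (j , i) refl (swap a) (swap b)
  EMsub-col⇔EMsub-row-swap {j = j} = mk⇔
    (λ (pa , pb , em) → pa , pb , InEM-≅ (≅-sym (row≅col H G j)) em)
    (λ (pa , pb , em) → pa , pb , InEM-≅ (row≅col H G j) em)

  EM-□⇒EMsub : Connected G → Connected H → ∀ {i j} a b → InEM (G □ H) (i , j) a b →
               InEMsub (G □ H) (rowP i) (i , j) refl a b ⊎ InEMsub (G □ H) (colP j) (i , j) refl a b
  EM-□⇒EMsub conn-G conn-H (a₁ , _) (.a₁ , _) em@(inj₁ (refl , _) , _) =
    inj₁ (GH.EM⇒EMsub-row conn-G conn-H em)
  EM-□⇒EMsub conn-G conn-H (_ , a₂) (_ , .a₂) em@(inj₂ (refl , _) , _) =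
    inj₂ (Equivalence.from EMsub-col⇔EMsub-row-swap
           (HG.EM⇒EMsub-row conn-H conn-G (InEM-≅ (□-swap G H) em)))

  EMsub⇒EM-□ : ∀ {i j a b} →
               InEMsub (G □ H) (rowP i) (i , j) refl a b ⊎ InEMsub (G □ H) (colP j) (i , j) refl a b →
               InEM (G □ H) (i , j) a b
  EMsub⇒EM-□ (inj₁ sub) = GH.EMsub-row⇒EM sub
  EMsub⇒EM-□ (inj₂ sub) =
    InEM-≅ (□-swap H G) (HG.EMsub-row⇒EM (Equivalence.to EMsub-col⇔EMsub-row-swap sub))

mainTheorem5 : (m n : ℕ) (G : Graph (Fin m)) (H : Graph (Fin n)) →
    Connected G → Connected H →
    (i : Fin m) (j : Fin n) (a b : Fin m × Fin n) →
    InEM (G □ H) (i , j) a b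
      ⇔ (InEMsub (G □ H) (rowP i) (i , j) refl a b
         ⊎ InEMsub (G □ H) (colP j) (i , j) refl a b)
mainTheorem5 m n G H conn-G conn-H i j a b =
  mk⇔ (EM-□⇒EMsub _≟ᶠ_ _≟ᶠ_ G H conn-G conn-H a b) (EMsub⇒EM-□ _≟ᶠ_ _≟ᶠ_ G H)
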